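{- Let $a$ be an integer with $a\notin\{0,1,-1\}$. For $n\geq0$ let $\zeta_{2n+1}=e^{2\pi i/(2n+1)}$ and $$G_n(x)=\prod_{l=1}^{n}(x-1-a\zeta_{2n+1}^l)(x-1-a\zeta_{2n+1}^{ -l})=\sum_{s=0}^{2n}b_sx^s.$$ Then $G_n(x)\in\mathbb{Z}[x]$ and: (1) $b_0=\frac{a^{2n+1}+1}{a+1}$, $b_{2n}=1$, and $b_{s-1}-(a+1)b_s=\binom{2n+1}{s}(-1)^{s+1}$ for $1\leq s\leq 2n-1$; (2) $G_0(x)=1$ and $G_{n+1}(x)=(x-1)^2G_n(x)+a^{2n+1}(x+a-1)$ for all $n\geq0$. -}

module Defs where

open import Level using (_⊔_)
open import Data.Nat as ℕ using (ℕ; zero; suc; _∸_)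
open import Data.Integer as ℤ using (ℤ; +_; -[1+_])
open import Data.Product using (_×_)
open import Relation.Nullary using (¬_)
open import Algebra.Bundles using (CommutativeRing)

odd : ℕ → ℕ
odd n = suc (2 ℕ.* n)

-- Polynomials over a commutative ring R, represented by their coefficient
-- sequences (coefficient of x^k at index k); equality is coefficientwise.
module Poly {c ℓ} (R : CommutativeRing c ℓ) where
  open CommutativeRing R hiding (zero)

  pow : Carrier → ℕ → Carrier
  pow x zero = 1#
  pow x (suc k) = x * pow x k

  ιℕ : ℕ → Carrier
  ιℕ zero = 0#
  ιℕ (suc n) = 1# + ιℕ n

  ι : ℤ → Carrier
  ι (+ n) = ιℕ n
  ι (-[1+ n ]) = - ιℕ (suc n)

  IsPrimitiveRoot : ℕ → Carrier → Set ℓ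
  IsPrimitiveRoot m z = (pow z m ≈ 1#) × (∀ k → 0 ℕ.< k → k ℕ.< m → ¬ (pow z k ≈ 1#))

  IsDomain : Set (c ⊔ ℓ)
  IsDomain = (¬ (1# ≈ 0#)) × (∀ x y → x * y ≈ 0# → (x ≈ 0#) Data.Sum.⊎ (y ≈ 0#))
    where import Data.Sum

  Polynomial : Set c
  Polynomial = ℕ → Carrier

  _≈ₚ_ : Polynomial → Polynomial → Set ℓ
  p ≈ₚ q = ∀ k → p k ≈ q k

  constₚ : Carrier → Polynomial
  constₚ r zero = r
  constₚ r (suc k) = 0#

  oneₚ : Polynomial
  oneₚ = constₚ 1#

  X-_ : Carrier → Polynomial
  (X- r) zero = - r
  (X- r) (suc zero) = 1#
  (X- r) (suc (suc k)) = 0#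

  _+ₚ_ : Polynomial → Polynomial → Polynomial
  (p +ₚ q) k = p k + q k

  sumTo : (ℕ → Carrier) → ℕ → Carrier
  sumTo f zero = f zero
  sumTo f (suc k) = sumTo f k + f (suc k)

  _*ₚ_ : Polynomial → Polynomial → Polynomial
  (p *ₚ q) k = sumTo (λ i → p i * q (k ∸ i)) k

  prod1 : (ℕ → Polynomial) → ℕ → Polynomial
  prod1 f zero = oneₚ
  prod1 f (suc n) = prod1 f n *ₚ f (suc n)

  -- G_n(x) = ∏_{l=1}^{n} (x - 1 - a ζ^l)(x - 1 - a ζ^{-l}),
  -- with ζ a primitive (2n+1)-th root of unity, so ζ^{-l} = ζ^{(2n+1)-l}.
  G : ℤ → Carrier → ℕ → Polynomial
  G a ζ n = prod1 (λ l → (X- (1# + ι a * pow ζ l)) *ₚ (X- (1# + ι a * pow ζ (odd n ∸ l)))) n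

{-# OPTIONS --safe #-}
-- Write α for the image of a and m = 2n + 1, and let uₗ = 1 + α ζˡ, so that G_n = ∏_{l=1}^{2n} (X - uₗ)
-- because ζ^{-l} = ζ^{m-l}. Both (X - u₀) G_n and (X - 1)^m - α^m are monic of degree m and vanish at
-- u₀, …, u_{2n} (as (uᵢ - 1)^m = α^m ζ^{im} = α^m); these m points are distinct unless α = 0, so the two
-- polynomials coincide, by root counting in a domain or by direct computation when α = 0. The polynomials
-- B_n defined by the recurrence (2) satisfy (X - 1 - α) B_n = (X - 1)^m - α^m by induction on n, hence
-- G_n = B_n after cancelling X - u₀. Taking α = a in ℤ, the same identity compared coefficientwise with
-- the binomial expansion of (X - 1)^m gives (1).
module Submission where

open import Data.Nat as ℕ using (ℕ; zero; suc; _∸_; z≤n; s≤s)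
import Data.Nat.Properties as ℕP
open import Data.Integer as ℤ using (ℤ; +_; -[1+_])
open import Data.Nat.Combinatorics using (_C_; nCk+nC[k+1]≡[n+1]C[k+1])
import Data.Integer.Properties as ℤP
open import Data.Product using (Σ; _×_; _,_; proj₁; proj₂)
open import Data.Sum as Sum using (_⊎_; inj₁; inj₂; [_,_]′)
open import Data.Maybe using (Maybe; just; nothing)
open import Data.Empty using (⊥-elim)
open import Relation.Nullary using (¬_; yes; no)
open import Relation.Binary.PropositionalEquality as P using (_≡_; _≢_)
open import Algebra.Bundles using (CommutativeRing)
import Algebra.Properties.Ring as RingProperties
import Algebra.Properties.AbelianGroup as AbelianGroupProperties
import Algebra.Properties.CommutativeSemigroup as CommutativeSemigroupProperties
import Algebra.Properties.Semiring.Exp as SemiringExpProperties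
import Algebra.Properties.CommutativeSemiring.Exp as CommutativeSemiringExpProperties
import Algebra.Solver.Ring as RingSolver
open import Algebra.Solver.Ring.AlmostCommutativeRing
  using (fromCommutativeRing; _-Raw-AlmostCommutative⟶_)
import Relation.Binary.Reasoning.Setoid as SetoidReasoning
open import Defs

module IntegerCast {c ℓ} (R : CommutativeRing c ℓ) where
  open CommutativeRing R hiding (zero)
  open Poly R using (ιℕ; ι; pow)
  open RingProperties ring using (-0#≈0#; -‿involutive; -‿distribˡ-*; -‿distribʳ-*)
  open AbelianGroupProperties +-abelianGroup using (⁻¹-∙-comm)
  open CommutativeSemigroupProperties +-commutativeSemigroup using (interchange)
  open SetoidReasoning setoid

  ιℕ-homo-+ : ∀ m n → ιℕ (m ℕ.+ n) ≈ ιℕ m + ιℕ n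
  ιℕ-homo-+ zero n = sym (+-identityˡ _)
  ιℕ-homo-+ (suc m) n = trans (+-congˡ (ιℕ-homo-+ m n)) (sym (+-assoc _ _ _))

  ιℕ-homo-* : ∀ m n → ιℕ (m ℕ.* n) ≈ ιℕ m * ιℕ n
  ιℕ-homo-* zero n = sym (zeroˡ _)
  ιℕ-homo-* (suc m) n = begin
    ιℕ (n ℕ.+ m ℕ.* n)      ≈⟨ ιℕ-homo-+ n (m ℕ.* n) ⟩
    ιℕ n + ιℕ (m ℕ.* n)     ≈⟨ +-cong (sym (*-identityˡ _)) (ιℕ-homo-* m n) ⟩
    1# * ιℕ n + ιℕ m * ιℕ n ≈⟨ distribʳ _ _ _ ⟨
    (1# + ιℕ m) * ιℕ n      ∎

  ι-homo-neg : ∀ x → ι (ℤ.- x) ≈ - ι x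
  ι-homo-neg (+ zero) = sym -0#≈0#
  ι-homo-neg (+ suc n) = refl
  ι-homo-neg -[1+ n ] = sym (-‿involutive _)

  [1+x]-[1+y]≈x-y : ∀ x y → (1# + x) - (1# + y) ≈ x - y
  [1+x]-[1+y]≈x-y x y = begin
    (1# + x) - (1# + y)      ≈⟨ +-congˡ (⁻¹-∙-comm 1# y) ⟨
    (1# + x) + (- 1# + - y)  ≈⟨ interchange 1# x (- 1#) (- y) ⟩
    (1# - 1#) + (x - y)      ≈⟨ +-congʳ (-‿inverseʳ 1#) ⟩
    0# + (x - y)             ≈⟨ +-identityˡ _ ⟩
    x - y                    ∎

  ι-homo-⊖ : ∀ m n → ι (m ℤ.⊖ n) ≈ ιℕ m - ιℕ n
  ι-homo-⊖ m zero = sym (trans (+-congˡ -0#≈0#) (+-identityʳ _))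
  ι-homo-⊖ zero (suc n) = sym (+-identityˡ _)
  ι-homo-⊖ (suc m) (suc n) = begin
    ι (suc m ℤ.⊖ suc n)        ≡⟨ P.cong ι (ℤP.[1+m]⊖[1+n]≡m⊖n m n) ⟩
    ι (m ℤ.⊖ n)                ≈⟨ ι-homo-⊖ m n ⟩
    ιℕ m - ιℕ n                ≈⟨ [1+x]-[1+y]≈x-y (ιℕ m) (ιℕ n) ⟨
    ιℕ (suc m) - ιℕ (suc n)    ∎

  ι-homo-+ : ∀ x y → ι (x ℤ.+ y) ≈ ι x + ι y
  ι-homo-+ (+ m) (+ n) = ιℕ-homo-+ m n
  ι-homo-+ (+ m) -[1+ n ] = ι-homo-⊖ m (suc n)
  ι-homo-+ -[1+ m ] (+ n) = trans (ι-homo-⊖ n (suc m)) (+-comm _ _)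
  ι-homo-+ -[1+ m ] -[1+ n ] = begin
    - ιℕ (suc (suc (m ℕ.+ n)))      ≡⟨ P.cong (λ k → - ιℕ (suc k)) (ℕP.+-suc m n) ⟨
    - ιℕ (suc m ℕ.+ suc n)          ≈⟨ -‿cong (ιℕ-homo-+ (suc m) (suc n)) ⟩
    - (ιℕ (suc m) + ιℕ (suc n))     ≈⟨ ⁻¹-∙-comm _ _ ⟨
    - ιℕ (suc m) + - ιℕ (suc n)     ∎

  ι-homo-*ˡ : ∀ m y → ι (+ m ℤ.* y) ≈ ιℕ m * ι y
  ι-homo-*ˡ m (+ n) = begin
    ι (+ m ℤ.* + n)   ≡⟨ P.cong ι (ℤP.pos-* m n) ⟨
    ιℕ (m ℕ.* n)      ≈⟨ ιℕ-homo-* m n ⟩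
    ιℕ m * ιℕ n       ∎
  ι-homo-*ˡ m -[1+ n ] = begin
    ι (+ m ℤ.* ℤ.- + suc n)       ≡⟨ P.cong ι (ℤP.neg-distribʳ-* (+ m) (+ suc n)) ⟨
    ι (ℤ.- (+ m ℤ.* + suc n))     ≈⟨ ι-homo-neg (+ m ℤ.* + suc n) ⟩
    - ι (+ m ℤ.* + suc n)         ≈⟨ -‿cong (ι-homo-*ˡ m (+ suc n)) ⟩
    - (ιℕ m * ιℕ (suc n))         ≈⟨ -‿distribʳ-* _ _ ⟩
    ιℕ m * - ιℕ (suc n)           ∎

  ι-homo-* : ∀ x y → ι (x ℤ.* y) ≈ ι x * ι y
  ι-homo-* (+ m) y = ι-homo-*ˡ m y
  ι-homo-* -[1+ m ] y = begin
    ι (ℤ.- + suc m ℤ.* y)        ≡⟨ P.cong ι (ℤP.neg-distribˡ-* (+ suc m) y) ⟨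
    ι (ℤ.- (+ suc m ℤ.* y))      ≈⟨ ι-homo-neg (+ suc m ℤ.* y) ⟩
    - ι (+ suc m ℤ.* y)          ≈⟨ -‿cong (ι-homo-*ˡ (suc m) y) ⟩
    - (ιℕ (suc m) * ι y)         ≈⟨ -‿distribˡ-* _ _ ⟩
    - ιℕ (suc m) * ι y           ∎

  ι-homo-1 : ι (+ 1) ≈ 1#
  ι-homo-1 = +-identityʳ 1#

  ι-homo-^ : ∀ x k → ι (x ℤ.^ k) ≈ pow (ι x) k
  ι-homo-^ x zero = ι-homo-1
  ι-homo-^ x (suc k) = trans (ι-homo-* x (x ℤ.^ k)) (*-congˡ (ι-homo-^ x k))

  -- ι with ι (+ 1) = 1# on the nose, so that the solver constant :1 denotes 1#.
  κℕ : ℕ → Carrier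
  κℕ zero = 0#
  κℕ (suc zero) = 1#
  κℕ (suc (suc n)) = 1# + κℕ (suc n)

  κ : ℤ → Carrier
  κ (+ n) = κℕ n
  κ -[1+ n ] = - κℕ (suc n)

  κℕ≈ιℕ : ∀ n → κℕ n ≈ ιℕ n
  κℕ≈ιℕ zero = refl
  κℕ≈ιℕ (suc zero) = sym ι-homo-1
  κℕ≈ιℕ (suc (suc n)) = +-congˡ (κℕ≈ιℕ (suc n))

  κ≈ι : ∀ x → κ x ≈ ι x
  κ≈ι (+ n) = κℕ≈ιℕ n
  κ≈ι -[1+ n ] = -‿cong (κℕ≈ιℕ (suc n))

  κ-homomorphism : ℤ.+-*-rawRing -Raw-AlmostCommutative⟶ fromCommutativeRing R
  κ-homomorphism = record
    { ⟦_⟧ = κ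
    ; +-homo = λ x y → transport (x ℤ.+ y) (ι-homo-+ x y) (+-cong (κ≈ι x) (κ≈ι y))
    ; *-homo = λ x y → transport (x ℤ.* y) (ι-homo-* x y) (*-cong (κ≈ι x) (κ≈ι y))
    ; -‿homo = λ x → transport (ℤ.- x) (ι-homo-neg x) (-‿cong (κ≈ι x))
    ; 0-homo = refl
    ; 1-homo = refl
    }
    where
    transport : ∀ z {x y} → ι z ≈ x → y ≈ x → κ z ≈ y
    transport z ιz≈x y≈x = trans (κ≈ι z) (trans ιz≈x (sym y≈x))

  κ-equal? : ∀ x y → Maybe (κ x ≈ κ y)
  κ-equal? x y with x ℤ.≟ y
  ... | yes P.refl = just refl
  ... | no _ = nothing

  private
    module Solver = RingSolver ℤ.+-*-rawRing (fromCommutativeRing R) κ-homomorphism κ-equal?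
  open Solver public using (solve; _:=_; _:+_; _:*_; _:-_; :-_)

  :0 :1 : ∀ {k} → Solver.Polynomial k
  :0 = Solver.con (+ 0)
  :1 = Solver.con (+ 1)

module Powers {c ℓ} (R : CommutativeRing c ℓ) where
  open CommutativeRing R hiding (zero)
  open Poly R using (pow)
  open SemiringExpProperties semiring using (_^_; ^-congˡ; ^-homo-*)
  open CommutativeSemiringExpProperties commutativeSemiring using (^-distrib-*)
  open SetoidReasoning setoid

  pow≡^ : ∀ x k → pow x k ≡ x ^ k
  pow≡^ x zero = P.refl
  pow≡^ x (suc k) = P.cong (x *_) (pow≡^ x k)

  pow-congˡ : ∀ k {x y} → x ≈ y → pow x k ≈ pow y k
  pow-congˡ k {x} {y} x≈y rewrite pow≡^ x k | pow≡^ y k = ^-congˡ k x≈y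

  pow-homo-+ : ∀ x m n → pow x (m ℕ.+ n) ≈ pow x m * pow x n
  pow-homo-+ x m n rewrite pow≡^ x (m ℕ.+ n) | pow≡^ x m | pow≡^ x n = ^-homo-* x m n

  pow-distrib-* : ∀ x y k → pow (x * y) k ≈ pow x k * pow y k
  pow-distrib-* x y k rewrite pow≡^ (x * y) k | pow≡^ x k | pow≡^ y k = ^-distrib-* x y k

  pow-1# : ∀ k → pow 1# k ≈ 1#
  pow-1# zero = refl
  pow-1# (suc k) = trans (*-identityˡ _) (pow-1# k)

  pow-root-of-unity : ∀ {z m} → pow z m ≈ 1# → ∀ i → pow (pow z i) m ≈ 1#
  pow-root-of-unity {z} {m} zᵐ≈1 zero = pow-1# m
  pow-root-of-unity {z} {m} zᵐ≈1 (suc i) = begin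
    pow (z * pow z i) m          ≈⟨ pow-distrib-* z (pow z i) m ⟩
    pow z m * pow (pow z i) m    ≈⟨ *-cong zᵐ≈1 (pow-root-of-unity {z} {m} zᵐ≈1 i) ⟩
    1# * 1#                      ≈⟨ *-identityˡ 1# ⟩
    1#                           ∎

module PrimitiveRoots {c ℓ} (R : CommutativeRing c ℓ) (domain : Poly.IsDomain R) where
  open CommutativeRing R hiding (zero)
  open Poly R using (pow; IsPrimitiveRoot)
  open IntegerCast R
  open Powers R
  open AbelianGroupProperties +-abelianGroup using (x∙y⁻¹≈ε⇒x≈y)
  open SetoidReasoning setoid

  root-of-unity-pow-nonzero : ∀ {z m i} → pow z m ≈ 1# → i ℕ.≤ m → ¬ (pow z i ≈ 0#)
  root-of-unity-pow-nonzero {z} {m} {i} zᵐ≈1 i≤m zⁱ≈0 = proj₁ domain (begin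
    1#                           ≈⟨ zᵐ≈1 ⟨
    pow z m                      ≡⟨ P.cong (pow z) (ℕP.m+[n∸m]≡n i≤m) ⟨
    pow z (i ℕ.+ (m ∸ i))        ≈⟨ pow-homo-+ z i (m ∸ i) ⟩
    pow z i * pow z (m ∸ i)      ≈⟨ *-congʳ zⁱ≈0 ⟩
    0# * pow z (m ∸ i)           ≈⟨ zeroˡ _ ⟩
    0#                           ∎)

  primitive-pow-injective : ∀ {m z i j} → IsPrimitiveRoot m z → i ℕ.< j → j ℕ.< m → ¬ (pow z j ≈ pow z i)
  primitive-pow-injective {m} {z} {i} {j} (zᵐ≈1 , minimal) i<j j<m zʲ≈zⁱ
    with proj₂ domain (pow z i) (pow z (j ∸ i) - 1#) factored≈0
    where
    factored≈0 : pow z i * (pow z (j ∸ i) - 1#) ≈ 0#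
    factored≈0 = begin
      pow z i * (pow z (j ∸ i) - 1#)
        ≈⟨ solve 2 (λ a b → a :* (b :- :1) := a :* b :- a) refl (pow z i) (pow z (j ∸ i)) ⟩
      pow z i * pow z (j ∸ i) - pow z i
        ≈⟨ +-congʳ (pow-homo-+ z i (j ∸ i)) ⟨
      pow z (i ℕ.+ (j ∸ i)) - pow z i
        ≡⟨ P.cong (λ k → pow z k - pow z i) (ℕP.m+[n∸m]≡n (ℕP.<⇒≤ i<j)) ⟩
      pow z j - pow z i  ≈⟨ +-congʳ zʲ≈zⁱ ⟩
      pow z i - pow z i  ≈⟨ -‿inverseʳ _ ⟩
      0#                 ∎
  ... | inj₁ zⁱ≈0 = root-of-unity-pow-nonzero zᵐ≈1 (ℕP.<⇒≤ (ℕP.<-trans i<j j<m)) zⁱ≈0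
  ... | inj₂ zʲ⁻ⁱ-1≈0 = minimal (j ∸ i) (ℕP.m<n⇒0<n∸m i<j) (ℕP.≤-<-trans (ℕP.m∸n≤m j i) j<m)
                                   (x∙y⁻¹≈ε⇒x≈y _ _ zʲ⁻ⁱ-1≈0)

module Polynomials {c ℓ} (R : CommutativeRing c ℓ) where
  open CommutativeRing R hiding (zero)
  open Poly R
  open IntegerCast R
  open SetoidReasoning setoid

  sumTo-cong : ∀ {f g} k → (∀ i → i ℕ.≤ k → f i ≈ g i) → sumTo f k ≈ sumTo g k
  sumTo-cong zero f≈g = f≈g 0 z≤n
  sumTo-cong (suc k) f≈g =
    +-cong (sumTo-cong k (λ i i≤k → f≈g i (ℕP.m≤n⇒m≤1+n i≤k))) (f≈g (suc k) ℕP.≤-refl)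

  sumTo-suc : ∀ f k → sumTo f (suc k) ≈ f 0 + sumTo (λ i → f (suc i)) k
  sumTo-suc f zero = refl
  sumTo-suc f (suc k) = trans (+-congʳ (sumTo-suc f k)) (+-assoc _ _ _)

  sumTo-reverse : ∀ f k → sumTo f k ≈ sumTo (λ i → f (k ∸ i)) k
  sumTo-reverse f zero = refl
  sumTo-reverse f (suc k) = begin
    sumTo f (suc k)                               ≈⟨ sumTo-suc f k ⟩
    f 0 + sumTo (λ i → f (suc i)) k               ≈⟨ +-congˡ (sumTo-reverse (λ i → f (suc i)) k) ⟩
    f 0 + sumTo (λ i → f (suc (k ∸ i))) k         ≈⟨ +-comm _ _ ⟩
    sumTo (λ i → f (suc (k ∸ i))) k + f 0
      ≈⟨ +-cong (sumTo-cong k λ i i≤k → reflexive (P.cong f (P.sym (ℕP.+-∸-assoc 1 i≤k))))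
                (reflexive (P.cong f (P.sym (ℕP.n∸n≡0 k)))) ⟩
    sumTo (λ i → f (suc k ∸ i)) k + f (k ∸ k)     ∎

  sumTo-beyond : ∀ {f} d j → (∀ i → d ℕ.< i → f i ≈ 0#) → sumTo f (j ℕ.+ d) ≈ sumTo f d
  sumTo-beyond d zero f≈0 = refl
  sumTo-beyond d (suc j) f≈0 =
    trans (+-cong (sumTo-beyond d j f≈0) (f≈0 _ (s≤s (ℕP.m≤n+m d j)))) (+-identityʳ _)

  *ₚ-comm : ∀ p q → (p *ₚ q) ≈ₚ (q *ₚ p)
  *ₚ-comm p q k = trans (sumTo-reverse (λ i → p i * q (k ∸ i)) k) (sumTo-cong k λ i i≤k →
    trans (*-comm _ _) (*-congʳ (reflexive (P.cong q (ℕP.m∸[m∸n]≡n i≤k)))))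

  *ₚ-degree≤2ˡ : ∀ q p j → (∀ i → q (3 ℕ.+ i) ≈ 0#) →
                 (q *ₚ p) (2 ℕ.+ j) ≈ (q 0 * p (2 ℕ.+ j) + q 1 * p (1 ℕ.+ j)) + q 2 * p j
  *ₚ-degree≤2ˡ q p j q≈0 = begin
    sumTo f (2 ℕ.+ j)   ≡⟨ P.cong (sumTo f) (ℕP.+-comm 2 j) ⟩
    sumTo f (j ℕ.+ 2)   ≈⟨ sumTo-beyond 2 j f≈0 ⟩
    sumTo f 2           ∎
    where
    f : ℕ → Carrier
    f i = q i * p ((2 ℕ.+ j) ∸ i)
    f≈0 : ∀ i → 2 ℕ.< i → f i ≈ 0#
    f≈0 (suc (suc (suc i))) _ = trans (*-congʳ (q≈0 i)) (zeroˡ _)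
    f≈0 (suc zero) (s≤s ())
    f≈0 (suc (suc zero)) (s≤s (s≤s ()))

  scale : Carrier → Polynomial → Polynomial
  scale a p k = a * p k

  infixl 6 _-ₚ_
  _-ₚ_ : Polynomial → Polynomial → Polynomial
  (p -ₚ q) k = p k - q k

  Degree< : ℕ → Polynomial → Set ℓ
  Degree< d p = ∀ k → d ℕ.≤ k → p k ≈ 0#

  Monic : ℕ → Polynomial → Set ℓ
  Monic d p = p d ≈ 1# × Degree< (suc d) p

  monic-resp : ∀ {d p q} → p ≈ₚ q → Monic d p → Monic d q
  monic-resp p≈q (p-top , p-deg) = trans (sym (p≈q _)) p-top , λ k d<k → trans (sym (p≈q k)) (p-deg k d<k)

  monic-+ : ∀ {d p q} → Monic d p → Degree< d q → Monic d (p +ₚ q)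
  monic-+ {d} (p-top , p-deg) q<d =
    trans (+-cong p-top (q<d d ℕP.≤-refl)) (+-identityʳ 1#) ,
    λ k d<k → trans (+-cong (p-deg k d<k) (q<d k (ℕP.<⇒≤ d<k))) (+-identityʳ 0#)

  monic-difference : ∀ {d p q} → Monic d p → Monic d q → Degree< d (p -ₚ q)
  monic-difference {d} (p-top , p-deg) (q-top , q-deg) k d≤k with ℕP.m≤n⇒m<n∨m≡n d≤k
  ... | inj₁ d<k = trans (+-cong (p-deg k d<k) (-‿cong (q-deg k d<k))) (-‿inverseʳ 0#)
  ... | inj₂ P.refl = trans (+-cong p-top (-‿cong q-top)) (-‿inverseʳ 1#)

  X-‿cong : ∀ {r s} → r ≈ s → (X- r) ≈ₚ (X- s)
  X-‿cong r≈s zero = -‿cong r≈s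
  X-‿cong r≈s (suc zero) = refl
  X-‿cong r≈s (suc (suc k)) = refl

  infixr 7 X-_·_
  X-_·_ : Carrier → Polynomial → Polynomial
  (X- r · p) zero = - r * p 0
  (X- r · p) (suc k) = p k - r * p (suc k)

  ·-cong : ∀ {r s p q} → r ≈ s → p ≈ₚ q → (X- r · p) ≈ₚ (X- s · q)
  ·-cong r≈s p≈q zero = *-cong (-‿cong r≈s) (p≈q 0)
  ·-cong r≈s p≈q (suc k) = +-cong (p≈q k) (-‿cong (*-cong r≈s (p≈q (suc k))))

  ·-comm : ∀ r s p → (X- r · X- s · p) ≈ₚ (X- s · X- r · p)
  ·-comm r s p zero =
    solve 3 (λ r s a → :- r :* (:- s :* a) := :- s :* (:- r :* a)) refl r s (p 0)
  ·-comm r s p (suc zero) =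
    solve 4 (λ r s a b → :- s :* a :- r :* (a :- s :* b) := :- r :* a :- s :* (a :- r :* b)) refl r s (p 0) (p 1)
  ·-comm r s p (suc (suc k)) =
    solve 5 (λ r s a b c → (a :- s :* b) :- r :* (b :- s :* c) := (a :- r :* b) :- s :* (b :- r :* c)) refl
      r s (p k) (p (suc k)) (p (suc (suc k)))

  ·-+ : ∀ r p q → (X- r · (p +ₚ q)) ≈ₚ ((X- r · p) +ₚ (X- r · q))
  ·-+ r p q zero = solve 3 (λ r a b → :- r :* (a :+ b) := :- r :* a :+ :- r :* b) refl r (p 0) (q 0)
  ·-+ r p q (suc k) =
    solve 5 (λ r a b c d → (a :+ b) :- r :* (c :+ d) := (a :- r :* c) :+ (b :- r :* d)) refl
      r (p k) (q k) (p (suc k)) (q (suc k))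

  ·-scale : ∀ r a p → (X- r · scale a p) ≈ₚ scale a (X- r · p)
  ·-scale r a p zero = solve 3 (λ r a x → :- r :* (a :* x) := a :* (:- r :* x)) refl r a (p 0)
  ·-scale r a p (suc k) =
    solve 4 (λ r a x y → a :* x :- r :* (a :* y) := a :* (x :- r :* y)) refl r a (p k) (p (suc k))

  ·-degree< : ∀ r {d p} → Degree< d p → Degree< (suc d) (X- r · p)
  ·-degree< r {p = p} p<d (suc k) (s≤s d≤k) = begin
    p k - r * p (suc k)  ≈⟨ +-cong (p<d k d≤k) (-‿cong (*-congˡ (p<d (suc k) (ℕP.m≤n⇒m≤1+n d≤k)))) ⟩
    0# - r * 0#          ≈⟨ solve 1 (λ r → :0 :- r :* :0 := :0) refl r ⟩
    0#                   ∎

  ·-monic : ∀ r {d p} → Monic d p → Monic (suc d) (X- r · p)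
  ·-monic r {d} {p} (p-top , p<d) = top , ·-degree< r p<d
    where
    top : p d - r * p (suc d) ≈ 1#
    top = begin
      p d - r * p (suc d)  ≈⟨ +-cong p-top (-‿cong (*-congˡ (p<d (suc d) ℕP.≤-refl))) ⟩
      1# - r * 0#          ≈⟨ solve 1 (λ r → :1 :- r :* :0 := :1) refl r ⟩
      1#                   ∎

  -- Comparing coefficients from the top down: p k is recovered as (X - r)p at k + 1 plus r p (k + 1).
  ·-cancel : ∀ r {d p q} → Degree< d p → Degree< d q → (X- r · p) ≈ₚ (X- r · q) → p ≈ₚ q
  ·-cancel r {d} {p} {q} p<d q<d rp≈rq k = go d k (ℕP.m≤m+n d k)
    where
    recover : ∀ f k → f k ≈ (X- r · f) (suc k) + r * f (suc k)
    recover f k = solve 3 (λ r a b → a := (a :- r :* b) :+ r :* b) refl r (f k) (f (suc k))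
    go : ∀ j k → d ℕ.≤ j ℕ.+ k → p k ≈ q k
    go zero k d≤k = trans (p<d k d≤k) (sym (q<d k d≤k))
    go (suc j) k d≤j+1+k = begin
      p k                                ≈⟨ recover p k ⟩
      (X- r · p) (suc k) + r * p (suc k)
        ≈⟨ +-cong (rp≈rq (suc k)) (*-congˡ (go j (suc k) (ℕP.≤-trans d≤j+1+k (ℕP.≤-reflexive (P.sym (ℕP.+-suc j k)))))) ⟩
      (X- r · q) (suc k) + r * q (suc k) ≈⟨ recover q k ⟨
      q k                                ∎

  quadratic-*ₚ : ∀ u v p → (((X- u) *ₚ (X- v)) *ₚ p) ≈ₚ (X- u · X- v · p)
  quadratic-*ₚ u v p zero =
    solve 3 (λ u v a → (:- u :* :- v) :* a := :- u :* (:- v :* a)) refl u v (p 0)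
  quadratic-*ₚ u v p (suc zero) =
    solve 4 (λ u v a b → (:- u :* :- v) :* b :+ (:- u :* :1 :+ :1 :* :- v) :* a
                         := :- v :* a :- u :* (a :- v :* b)) refl u v (p 0) (p 1)
  quadratic-*ₚ u v p (suc (suc j)) = begin
    (q *ₚ p) (2 ℕ.+ j)                                     ≈⟨ *ₚ-degree≤2ˡ q p j q-degree ⟩
    (q 0 * p (2 ℕ.+ j) + q 1 * p (1 ℕ.+ j)) + q 2 * p j  ≈⟨ solve 5 (λ u v a b c →
        ((:- u :* :- v) :* c :+ (:- u :* :1 :+ :1 :* :- v) :* b)
          :+ ((:- u :* :0 :+ :1 :* :1) :+ :0 :* :- v) :* a
        := (a :- v :* b) :- u :* (b :- v :* c)) refl u v (p j) (p (suc j)) (p (suc (suc j))) ⟩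
    (X- u · X- v · p) (2 ℕ.+ j)                            ∎
    where
    q : Polynomial
    q = (X- u) *ₚ (X- v)
    q-degree : ∀ i → q (3 ℕ.+ i) ≈ 0#
    q-degree i = begin
      q (2 ℕ.+ suc i)  ≈⟨ *ₚ-degree≤2ˡ (X- u) (X- v) (suc i) X-u-degree ⟩
      (- u * 0# + 1# * 0#) + 0# * (X- v) (suc i)
        ≈⟨ solve 2 (λ u w → (:- u :* :0 :+ :1 :* :0) :+ :0 :* w := :0)
             refl u ((X- v) (suc i)) ⟩
      0# ∎
      where
      X-u-degree : ∀ i → (X- u) (3 ℕ.+ i) ≈ 0#
      X-u-degree i = refl

  constₚ-*ₚ : ∀ a p → (constₚ a *ₚ p) ≈ₚ scale a p
  constₚ-*ₚ a p zero = refl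
  constₚ-*ₚ a p (suc zero) = solve 3 (λ a x y → a :* y :+ :0 :* x := a :* y) refl a (p 0) (p 1)
  constₚ-*ₚ a p (suc (suc j)) = trans (*ₚ-degree≤2ˡ (constₚ a) p j const-degree)
    (solve 4 (λ a x y z → (a :* z :+ :0 :* y) :+ :0 :* x := a :* z) refl a (p j) (p (suc j)) (p (suc (suc j))))
    where
    const-degree : ∀ i → constₚ a (3 ℕ.+ i) ≈ 0#
    const-degree i = refl

  [X-1]^_ : ℕ → Polynomial
  [X-1]^ zero = oneₚ
  [X-1]^ suc j = X- 1# · [X-1]^ j

  [X-1]^-monic : ∀ j → Monic j ([X-1]^ j)
  [X-1]^-monic zero = refl , λ { (suc k) _ → refl }
  [X-1]^-monic (suc j) = ·-monic 1# ([X-1]^-monic j)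

  -- Σ_{k<d} p k s^k, the value p(s) whenever Degree< d p.
  eval : ℕ → Polynomial → Carrier → Carrier
  eval zero p s = 0#
  eval (suc d) p s = eval d p s + p d * pow s d

  eval-cong : ∀ d {p q} → (∀ k → k ℕ.< d → p k ≈ q k) → ∀ s → eval d p s ≈ eval d q s
  eval-cong zero p≈q s = refl
  eval-cong (suc d) p≈q s =
    +-cong (eval-cong d (λ k k<d → p≈q k (ℕP.m≤n⇒m≤1+n k<d)) s) (*-congʳ (p≈q d ℕP.≤-refl))

  eval-suc : ∀ d p s → p d ≈ 0# → eval (suc d) p s ≈ eval d p s
  eval-suc d p s pd≈0 = trans (+-congˡ (trans (*-congʳ pd≈0) (zeroˡ _))) (+-identityʳ _)

  eval-horner : ∀ d p s → eval (suc d) p s ≈ p 0 + s * eval d (λ k → p (suc k)) s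
  eval-horner zero p s = solve 2 (λ a s → :0 :+ a :* :1 := a :+ s :* :0) refl (p 0) s
  eval-horner (suc d) p s = begin
    eval (suc d) p s + p (suc d) * (s * pow s d)  ≈⟨ +-congʳ (eval-horner d p s) ⟩
    (p 0 + s * e) + p (suc d) * (s * pow s d)
      ≈⟨ solve 5 (λ a s e b t → (a :+ s :* e) :+ b :* (s :* t) := a :+ s :* (e :+ b :* t)) refl (p 0) s e (p (suc d)) (pow s d) ⟩
    p 0 + s * (e + p (suc d) * pow s d)           ∎
    where
    e : Carrier
    e = eval d (λ k → p (suc k)) s

  eval-· : ∀ d r p s → p d ≈ 0# → eval (suc d) (X- r · p) s ≈ (s - r) * eval d p s
  eval-· d r p s pd≈0 = begin
    eval (suc d) (X- r · p) s         ≈⟨ expand d ⟩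
    s * eval d p s - r * eval (suc d) p s ≈⟨ +-congˡ (-‿cong (*-congˡ (eval-suc d p s pd≈0))) ⟩
    s * eval d p s - r * eval d p s   ≈⟨ solve 3 (λ s r e → s :* e :- r :* e := (s :- r) :* e) refl s r (eval d p s) ⟩
    (s - r) * eval d p s              ∎
    where
    expand : ∀ d → eval (suc d) (X- r · p) s ≈ s * eval d p s - r * eval (suc d) p s
    expand zero = solve 3 (λ r a s → :0 :+ (:- r :* a) :* :1
                                    := s :* :0 :- r :* (:0 :+ a :* :1)) refl r (p 0) s
    expand (suc d) = begin
      eval (suc d) (X- r · p) s + (p d - r * p (suc d)) * (s * pow s d)
        ≈⟨ +-congʳ (expand d) ⟩
      (s * eval d p s - r * (eval d p s + p d * pow s d)) + (p d - r * p (suc d)) * (s * pow s d)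
        ≈⟨ solve 6 (λ s r e a b t → (s :* e :- r :* (e :+ a :* t)) :+ (a :- r :* b) :* (s :* t)
                                   := s :* (e :+ a :* t) :- r :* ((e :+ a :* t) :+ b :* (s :* t)))
             refl s r (eval d p s) (p d) (p (suc d)) (pow s d) ⟩
      s * eval (suc d) p s - r * eval (suc (suc d)) p s ∎

  eval-difference : ∀ d p q s → eval d (p -ₚ q) s ≈ eval d p s - eval d q s
  eval-difference zero p q s = solve 0 (:0 := :0 :- :0) refl
  eval-difference (suc d) p q s = trans (+-congʳ (eval-difference d p q s))
    (solve 5 (λ a b x y t → (a :- b) :+ (x :- y) :* t := (a :+ x :* t) :- (b :+ y :* t)) refl
       (eval d p s) (eval d q s) (p d) (q d) (pow s d))

  eval-+ₚ : ∀ d p q s → eval d (p +ₚ q) s ≈ eval d p s + eval d q s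
  eval-+ₚ zero p q s = sym (+-identityʳ 0#)
  eval-+ₚ (suc d) p q s = trans (+-congʳ (eval-+ₚ d p q s))
    (solve 5 (λ a b x y t → (a :+ b) :+ (x :+ y) :* t := (a :+ x :* t) :+ (b :+ y :* t)) refl
       (eval d p s) (eval d q s) (p d) (q d) (pow s d))

  eval-scale : ∀ d a p s → eval d (scale a p) s ≈ a * eval d p s
  eval-scale zero a p s = sym (zeroʳ a)
  eval-scale (suc d) a p s = trans (+-congʳ (eval-scale d a p s))
    (solve 4 (λ a e x t → a :* e :+ a :* x :* t := a :* (e :+ x :* t)) refl a (eval d p s) (p d) (pow s d))

  eval-constₚ : ∀ d a s → eval (suc d) (constₚ a) s ≈ a
  eval-constₚ zero a s = solve 1 (λ a → :0 :+ a :* :1 := a) refl a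
  eval-constₚ (suc d) a s = trans (eval-suc (suc d) (constₚ a) s refl) (eval-constₚ d a s)

  eval-[X-1]^ : ∀ j s → eval (suc j) ([X-1]^ j) s ≈ pow (s - 1#) j
  eval-[X-1]^ zero s = solve 0 (:0 :+ :1 :* :1 := :1) refl
  eval-[X-1]^ (suc j) s = begin
    eval (2 ℕ.+ j) (X- 1# · [X-1]^ j) s
      ≈⟨ eval-· (suc j) 1# ([X-1]^ j) s (proj₂ ([X-1]^-monic j) (suc j) ℕP.≤-refl) ⟩
    (s - 1#) * eval (suc j) ([X-1]^ j) s  ≈⟨ *-congˡ (eval-[X-1]^ j s) ⟩
    (s - 1#) * pow (s - 1#) j             ∎

  -- The coefficients of (p - p(r)) / (X - r) for p of degree < d.
  quotient : ℕ → Carrier → Polynomial → Polynomial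
  quotient zero r p k = 0#
  quotient (suc d) r p zero = eval d (λ k → p (suc k)) r
  quotient (suc d) r p (suc k) = quotient d r (λ k → p (suc k)) k

  eval-quotient : ∀ d p r s → eval (suc d) p s ≈ (s - r) * eval d (quotient (suc d) r p) s + eval (suc d) p r
  eval-quotient zero p r s =
    solve 3 (λ s r a → :0 :+ a :* :1 := (s :- r) :* :0 :+ (:0 :+ a :* :1)) refl s r (p 0)
  eval-quotient (suc d) p r s = begin
    eval (2 ℕ.+ d) p s                ≈⟨ eval-horner (suc d) p s ⟩
    p 0 + s * eval (suc d) p′ s       ≈⟨ +-congˡ (*-congˡ (eval-quotient d p′ r s)) ⟩
    p 0 + s * ((s - r) * q + p′r)
      ≈⟨ solve 5 (λ a s r q b → a :+ s :* ((s :- r) :* q :+ b) := (s :- r) :* (b :+ s :* q) :+ (a :+ r :* b))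
           refl (p 0) s r q p′r ⟩
    (s - r) * (p′r + s * q) + (p 0 + r * p′r)
      ≈⟨ +-cong (*-congˡ (eval-horner d (quotient (2 ℕ.+ d) r p) s)) (eval-horner (suc d) p r) ⟨
    (s - r) * eval (suc d) (quotient (2 ℕ.+ d) r p) s + eval (2 ℕ.+ d) p r ∎
    where
    p′ : Polynomial
    p′ k = p (suc k)
    q p′r : Carrier
    q = eval d (quotient (suc d) r p′) s
    p′r = eval (suc d) p′ r

  x+y≈0∧y≈0⇒x≈0 : ∀ {x y} → x + y ≈ 0# → y ≈ 0# → x ≈ 0#
  x+y≈0∧y≈0⇒x≈0 x+y≈0 y≈0 = trans (sym (+-identityʳ _)) (trans (+-congˡ (sym y≈0)) x+y≈0)

  quotient-vanishing : ∀ d p r → (∀ k → k ℕ.< d → quotient (suc d) r p k ≈ 0#) → eval (suc d) p r ≈ 0# →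
                       ∀ k → k ℕ.< suc d → p k ≈ 0#
  quotient-vanishing zero p r _ p[r]≈0 zero _ =
    trans (solve 1 (λ a → a := :0 :+ a :* :1) refl (p 0)) p[r]≈0
  quotient-vanishing zero p r _ _ (suc k) (s≤s ())
  quotient-vanishing (suc d) p r q≈0 p[r]≈0 zero _ =
    x+y≈0∧y≈0⇒x≈0 (trans (sym (eval-horner (suc d) p r)) p[r]≈0) (trans (*-congˡ (q≈0 0 (s≤s z≤n))) (zeroʳ _))
  quotient-vanishing (suc d) p r q≈0 p[r]≈0 (suc k) (s≤s k<1+d) =
    quotient-vanishing d (λ k → p (suc k)) r (λ k k<d → q≈0 (suc k) (s≤s k<d)) (q≈0 0 (s≤s z≤n)) k k<1+d

  -- Root counting. Coinciding points and non-vanishing are only excluded up to an alternative E, which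
  -- keeps the argument constructive when equality of points is undecidable.
  module RootCounting (no-zero-divisors : ∀ x y → x * y ≈ 0# → x ≈ 0# ⊎ y ≈ 0#) {e} (E : Set e) where

    roots⇒zero : ∀ d (ρ : ℕ → Carrier) p →
                 (∀ i j → i ℕ.< j → j ℕ.< d → ρ j - ρ i ≈ 0# → E) →
                 (∀ i → i ℕ.< d → E ⊎ eval d p (ρ i) ≈ 0#) →
                 E ⊎ (∀ k → k ℕ.< d → p k ≈ 0#)
    roots⇒zero zero ρ p distinct vanish = inj₂ λ k ()
    roots⇒zero (suc d) ρ p distinct vanish = [ inj₁ , divide ]′ (vanish 0 (s≤s z≤n))
      where
      r : Carrier
      r = ρ 0
      q : Polynomial
      q = quotient (suc d) r p
      divide : eval (suc d) p r ≈ 0# → E ⊎ (∀ k → k ℕ.< suc d → p k ≈ 0#)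
      divide p[r]≈0 = Sum.map₂ (λ q≈0 → quotient-vanishing d p r q≈0 p[r]≈0)
                        (roots⇒zero d (λ i → ρ (suc i)) q
                           (λ i j i<j j<d → distinct (suc i) (suc j) (s≤s i<j) (s≤s j<d))
                           (λ i i<d → [ inj₁ , q-vanishes i i<d ]′ (vanish (suc i) (s≤s i<d))))
        where
        q-vanishes : ∀ i → i ℕ.< d → eval (suc d) p (ρ (suc i)) ≈ 0# → E ⊎ eval d q (ρ (suc i)) ≈ 0#
        q-vanishes i i<d p[s]≈0 =
          Sum.map₁ (distinct 0 (suc i) (s≤s z≤n) (s≤s i<d)) (no-zero-divisors _ _
            (x+y≈0∧y≈0⇒x≈0 (trans (sym (eval-quotient d p r (ρ (suc i)))) p[s]≈0) p[r]≈0))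

  module QuadraticFactors (u v : ℕ → Carrier) where

    factor : ℕ → Polynomial
    factor l = (X- u l) *ₚ (X- v l)

    prod1-suc : ∀ j → prod1 factor (suc j) ≈ₚ (X- u (suc j) · X- v (suc j) · prod1 factor j)
    prod1-suc j k = trans (*ₚ-comm (prod1 factor j) (factor (suc j)) k) (quadratic-*ₚ (u (suc j)) (v (suc j)) _ k)

    prod1-monic : ∀ j → Monic (2 ℕ.* j) (prod1 factor j)
    prod1-monic zero = refl , λ { (suc k) _ → refl }
    prod1-monic (suc j) = P.subst (λ d → Monic d (prod1 factor (suc j))) (P.sym (ℕP.*-suc 2 j))
      (monic-resp (λ k → sym (prod1-suc j k)) (·-monic (u (suc j)) (·-monic (v (suc j)) (prod1-monic j))))

    eval-prod1-suc : ∀ j s → eval (suc (2 ℕ.* suc j)) (prod1 factor (suc j)) s ≈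
                             (s - u (suc j)) * ((s - v (suc j)) * eval (suc (2 ℕ.* j)) (prod1 factor j) s)
    eval-prod1-suc j s = begin
      eval (suc (2 ℕ.* suc j)) (prod1 factor (suc j)) s
        ≡⟨ P.cong (λ d → eval (suc d) (prod1 factor (suc j)) s) (ℕP.*-suc 2 j) ⟩
      eval (3 ℕ.+ 2 ℕ.* j) (prod1 factor (suc j)) s
        ≈⟨ eval-cong (3 ℕ.+ 2 ℕ.* j) (λ k _ → prod1-suc j k) s ⟩
      eval (3 ℕ.+ 2 ℕ.* j) (X- u (suc j) · X- v (suc j) · P) s
        ≈⟨ eval-· (2 ℕ.+ 2 ℕ.* j) (u (suc j)) _ s (proj₂ (·-monic (v (suc j)) (prod1-monic j)) _ ℕP.≤-refl) ⟩
      (s - u (suc j)) * eval (2 ℕ.+ 2 ℕ.* j) (X- v (suc j) · P) s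
        ≈⟨ *-congˡ (eval-· (suc (2 ℕ.* j)) (v (suc j)) P s (proj₂ (prod1-monic j) _ ℕP.≤-refl)) ⟩
      (s - u (suc j)) * ((s - v (suc j)) * eval (suc (2 ℕ.* j)) P s) ∎
      where
      P : Polynomial
      P = prod1 factor j

    prod1-root : ∀ j l s → 1 ℕ.≤ l → l ℕ.≤ j → s ≈ u l ⊎ s ≈ v l →
                 eval (suc (2 ℕ.* j)) (prod1 factor j) s ≈ 0#
    prod1-root zero (suc l) s _ () _
    prod1-root (suc j) l s 1≤l l≤1+j s≈root with ℕP.m≤n⇒m<n∨m≡n l≤1+j
    ... | inj₁ (s≤s l≤j) =
      trans (eval-prod1-suc j s)
        (trans (*-congˡ (*-congˡ (prod1-root j l s 1≤l l≤j s≈root))) (trans (*-congˡ (zeroʳ _)) (zeroʳ _)))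
    ... | inj₂ P.refl = trans (eval-prod1-suc j s) ([ root-of-first , root-of-second ]′ s≈root)
      where
      root-of-first : s ≈ u l → _ ≈ 0#
      root-of-first s≈u = trans (*-congʳ (trans (+-congʳ s≈u) (-‿inverseʳ _))) (zeroˡ _)
      root-of-second : s ≈ v l → _ ≈ 0#
      root-of-second s≈v = trans (*-congˡ (trans (*-congʳ (trans (+-congʳ s≈v) (-‿inverseʳ _))) (zeroˡ _))) (zeroʳ _)

    prod1-unit-roots : (∀ l → u l ≈ 1#) → (∀ l → v l ≈ 1#) → ∀ j → prod1 factor j ≈ₚ ([X-1]^ (2 ℕ.* j))
    prod1-unit-roots u≈1 v≈1 zero k = refl
    prod1-unit-roots u≈1 v≈1 (suc j) k = begin
      prod1 factor (suc j) k                          ≈⟨ prod1-suc j k ⟩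
      (X- u (suc j) · X- v (suc j) · prod1 factor j) k
        ≈⟨ ·-cong (u≈1 (suc j)) (·-cong (v≈1 (suc j)) (prod1-unit-roots u≈1 v≈1 j)) k ⟩
      ([X-1]^ (2 ℕ.+ 2 ℕ.* j)) k                      ≡⟨ P.cong (λ d → ([X-1]^ d) k) (ℕP.*-suc 2 j) ⟨
      ([X-1]^ (2 ℕ.* suc j)) k                        ∎

odd-suc : ∀ n → odd (suc n) ≡ 2 ℕ.+ odd n
odd-suc n = P.cong suc (ℕP.*-suc 2 n)

odd∸>≤ : ∀ n i → n ℕ.< i → odd n ∸ i ℕ.≤ n
odd∸>≤ n i n<i = ℕP.m≤n+o⇒m∸n≤o (odd n) i
  (ℕP.≤-trans (ℕP.≤-reflexive (P.cong (λ x → suc (n ℕ.+ x)) (ℕP.+-identityʳ n))) (ℕP.+-monoˡ-≤ n n<i))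

module Recurrence {c ℓ} (R : CommutativeRing c ℓ) (α : CommutativeRing.Carrier R) where
  open CommutativeRing R hiding (zero)
  open Poly R
  open IntegerCast R
  open Polynomials R
  open SetoidReasoning setoid

  B : ℕ → Polynomial
  B zero = oneₚ
  B (suc n) = (X- 1# · X- 1# · B n) +ₚ scale (pow α (odd n)) (X- (1# - α))

  B-monic : ∀ n → Monic (2 ℕ.* n) (B n)
  B-monic zero = refl , λ { (suc k) _ → refl }
  B-monic (suc n) = P.subst (λ d → Monic d (B (suc n))) (P.sym (ℕP.*-suc 2 n))
    (monic-+ (·-monic 1# (·-monic 1# (B-monic n))) linear-part)
    where
    linear-part : Degree< (2 ℕ.+ 2 ℕ.* n) (scale (pow α (odd n)) (X- (1# - α)))
    linear-part (suc zero) (s≤s ())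
    linear-part (suc (suc k)) _ = zeroʳ _

  difference-of-powers : ℕ → Polynomial
  difference-of-powers m = ([X-1]^ m) +ₚ scale (- pow α m) oneₚ

  difference-of-squares : (X- (1# + α) · X- (1# - α)) ≈ₚ ((X- 1# · X- 1# · oneₚ) +ₚ scale (- (α * α)) oneₚ)
  difference-of-squares zero =
    solve 1 (λ a → :- (:1 :+ a) :* :- (:1 :- a)
                 := :- :1 :* (:- :1 :* :1) :+ :- (a :* a) :* :1) refl α
  difference-of-squares (suc zero) =
    solve 1 (λ a → :- (:1 :- a) :- (:1 :+ a) :* :1
                 := (:- :1 :* :1 :- :1 :* (:1 :- :1 :* :0)) :+ :- (a :* a) :* :0) refl α
  difference-of-squares (suc (suc zero)) =
    solve 1 (λ a → :1 :- (:1 :+ a) :* :0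
                 := ((:1 :- :1 :* :0) :- :1 :* (:0 :- :1 :* :0)) :+ :- (a :* a) :* :0) refl α
  difference-of-squares (suc (suc (suc k))) =
    solve 1 (λ a → :0 :- (:1 :+ a) :* :0
                 := ((:0 :- :1 :* :0) :- :1 :* (:0 :- :1 :* :0)) :+ :- (a :* a) :* :0) refl α

  X-[1+α]·B≈difference-of-powers : ∀ n → (X- (1# + α) · B n) ≈ₚ difference-of-powers (odd n)
  X-[1+α]·B≈difference-of-powers zero zero =
    solve 1 (λ a → :- (:1 :+ a) :* :1 := :- :1 :* :1 :+ :- (a :* :1) :* :1) refl α
  X-[1+α]·B≈difference-of-powers zero (suc zero) =
    solve 1 (λ a → :1 :- (:1 :+ a) :* :0
                 := (:1 :- :1 :* :0) :+ :- (a :* :1) :* :0) refl α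
  X-[1+α]·B≈difference-of-powers zero (suc (suc k)) =
    solve 1 (λ a → :0 :- (:1 :+ a) :* :0
                 := (:0 :- :1 :* :0) :+ :- (a :* :1) :* :0) refl α
  X-[1+α]·B≈difference-of-powers (suc n) k = begin
    (X- r · B (suc n)) k
      ≈⟨ ·-+ r M (scale αᵐ L) k ⟩
    (X- r · M) k + (X- r · scale αᵐ L) k
      ≈⟨ +-cong (trans (·-comm r 1# _ k) (·-cong refl (·-comm r 1# (B n)) k)) (·-scale r αᵐ L k) ⟩
    (X- 1# · X- 1# · X- r · B n) k + αᵐ * (X- r · L) k
      ≈⟨ +-cong (·-cong refl (·-cong refl (X-[1+α]·B≈difference-of-powers n)) k) (*-congˡ (difference-of-squares k)) ⟩
    (X- 1# · X- 1# · difference-of-powers m) k + αᵐ * (Q k + - (α * α) * oneₚ k)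
      ≈⟨ +-congʳ (trans (·-cong refl (·-+ 1# ([X-1]^ m) S) k)
                  (trans (·-+ 1# _ _ k)
                  (+-congˡ (trans (·-cong refl (·-scale 1# (- αᵐ) oneₚ) k) (·-scale 1# (- αᵐ) _ k))))) ⟩
    (([X-1]^ (2 ℕ.+ m)) k + - αᵐ * Q k) + αᵐ * (Q k + - (α * α) * oneₚ k)
      ≈⟨ solve 5 (λ a c w q o → (w :+ :- c :* q) :+ c :* (q :+ :- (a :* a) :* o) := w :+ :- (a :* (a :* c)) :* o)
           refl α αᵐ (([X-1]^ (2 ℕ.+ m)) k) (Q k) (oneₚ k) ⟩
    difference-of-powers (2 ℕ.+ m) k
      ≡⟨ P.cong (λ d → difference-of-powers d k) (odd-suc n) ⟨
    difference-of-powers (odd (suc n)) k ∎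
    where
    m : ℕ
    m = odd n
    r αᵐ : Carrier
    r = 1# + α
    αᵐ = pow α m
    M L Q S : Polynomial
    M = X- 1# · X- 1# · B n
    L = X- (1# - α)
    Q = X- 1# · X- 1# · oneₚ
    S = scale (- αᵐ) oneₚ

module IntegerCoefficients (a : ℤ) where
  open import Data.Integer using (_+_; _-_; _*_; _^_; -_)
  open Poly ℤP.+-*-commutativeRing using (pow)
  open IntegerCast ℤP.+-*-commutativeRing using (solve; _:=_; _:+_; _:*_; _:-_; :-_; :0; :1)
  open Polynomials ℤP.+-*-commutativeRing using ([X-1]^_)
  open Recurrence ℤP.+-*-commutativeRing a public using (B; B-monic; X-[1+α]·B≈difference-of-powers)
  open P.≡-Reasoning

  pow≡ℤ^ : ∀ x k → pow x k ≡ x ^ k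
  pow≡ℤ^ x zero = P.refl
  pow≡ℤ^ x (suc k) = P.cong (x *_) (pow≡ℤ^ x k)

  -1^[2n+k]≡-1^k : ∀ n k → (- + 1) ^ (2 ℕ.* n ℕ.+ k) ≡ (- + 1) ^ k
  -1^[2n+k]≡-1^k n k = begin
    (- + 1) ^ (2 ℕ.* n ℕ.+ k)            ≡⟨ ℤP.^-distribˡ-+-* (- + 1) (2 ℕ.* n) k ⟩
    (- + 1) ^ (2 ℕ.* n) * (- + 1) ^ k    ≡⟨ P.cong (λ x → x * (- + 1) ^ k) (ℤP.^-*-assoc (- + 1) 2 n) ⟨
    (+ 1) ^ n * (- + 1) ^ k              ≡⟨ P.cong (λ x → x * (- + 1) ^ k) (ℤP.^-zeroˡ n) ⟩
    + 1 * (- + 1) ^ k                    ≡⟨ ℤP.*-identityˡ _ ⟩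
    (- + 1) ^ k                          ∎

  [X-1]^-coefficient : ∀ j k → ([X-1]^ j) k ≡ + (j C k) * (- + 1) ^ (j ℕ.+ k)
  [X-1]^-coefficient zero zero = P.refl
  [X-1]^-coefficient zero (suc k) = P.refl
  [X-1]^-coefficient (suc j) zero = begin
    - + 1 * ([X-1]^ j) 0                    ≡⟨ P.cong (λ x → - + 1 * x) ([X-1]^-coefficient j 0) ⟩
    - + 1 * (+ 1 * (- + 1) ^ (j ℕ.+ 0))
      ≡⟨ solve 1 (λ x → :- :1 :* (:1 :* x) := :1 :* (:- :1 :* x)) P.refl _ ⟩
    + 1 * (- + 1) ^ (suc j ℕ.+ 0)           ∎
  [X-1]^-coefficient (suc j) (suc k) = begin
    ([X-1]^ j) k - + 1 * ([X-1]^ j) (suc k)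
      ≡⟨ P.cong₂ (λ x y → x - + 1 * y) ([X-1]^-coefficient j k) ([X-1]^-coefficient j (suc k)) ⟩
    + (j C k) * σ - + 1 * (+ (j C suc k) * (- + 1) ^ (j ℕ.+ suc k))
      ≡⟨ P.cong (λ e → + (j C k) * σ - + 1 * (+ (j C suc k) * (- + 1) ^ e)) (ℕP.+-suc j k) ⟩
    + (j C k) * σ - + 1 * (+ (j C suc k) * (- + 1 * σ))
      ≡⟨ solve 3 (λ x y σ → x :* σ :- :1 :* (y :* (:- :1 :* σ))
                            := (x :+ y) :* (:- :1 :* (:- :1 :* σ))) P.refl (+ (j C k)) (+ (j C suc k)) σ ⟩
    (+ (j C k) + + (j C suc k)) * (- + 1 * (- + 1 * σ))
      ≡⟨ P.cong₂ (λ x e → x * (- + 1 * e)) (ℤP.pos-+ (j C k) (j C suc k)) (P.cong ((- + 1) ^_) (ℕP.+-suc j k)) ⟨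
    + (j C k ℕ.+ j C suc k) * (- + 1) ^ (suc j ℕ.+ suc k)
      ≡⟨ P.cong (λ x → + x * (- + 1) ^ (suc j ℕ.+ suc k)) (nCk+nC[k+1]≡[n+1]C[k+1] j k) ⟩
    + (suc j C suc k) * (- + 1) ^ (suc j ℕ.+ suc k) ∎
    where
    σ : ℤ
    σ = (- + 1) ^ (j ℕ.+ k)

  B-constant-term : ∀ n → B n 0 * (a + + 1) ≡ a ^ odd n + + 1
  B-constant-term n = begin
    B n 0 * (a + + 1)
      ≡⟨ solve 2 (λ a b → b :* (a :+ :1) := :- (:- (:1 :+ a) :* b)) P.refl a (B n 0) ⟩
    - (- (+ 1 + a) * B n 0)
      ≡⟨ P.cong -_ (X-[1+α]·B≈difference-of-powers n 0) ⟩
    - (([X-1]^ m) 0 + - pow a m * + 1)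
      ≡⟨ P.cong (λ x → - (x + - pow a m * + 1)) ([X-1]^-coefficient m 0) ⟩
    - (+ 1 * (- + 1 * (- + 1) ^ (2 ℕ.* n ℕ.+ 0)) + - pow a m * + 1)
      ≡⟨ P.cong (λ x → - (+ 1 * (- + 1 * x) + - pow a m * + 1)) (-1^[2n+k]≡-1^k n 0) ⟩
    - (+ 1 * (- + 1 * + 1) + - pow a m * + 1)
      ≡⟨ solve 1 (λ x → :- (:1 :* (:- :1 :* :1) :+ :- x :* :1) := x :+ :1) P.refl (pow a m) ⟩
    pow a m + + 1
      ≡⟨ P.cong (_+ + 1) (pow≡ℤ^ a m) ⟩
    a ^ m + + 1 ∎
    where
    m : ℕ
    m = odd n

  B-consecutive : ∀ n s → B n s - (a + + 1) * B n (suc s) ≡ + (odd n C suc s) * (- + 1) ^ suc (suc s)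
  B-consecutive n s = begin
    B n s - (a + + 1) * B n (suc s)                     ≡⟨ P.cong (λ x → B n s - x * B n (suc s)) (ℤP.+-comm a (+ 1)) ⟩
    B n s - (+ 1 + a) * B n (suc s)                     ≡⟨ X-[1+α]·B≈difference-of-powers n (suc s) ⟩
    ([X-1]^ m) (suc s) + - pow a m * + 0                ≡⟨ P.cong (_+_ (([X-1]^ m) (suc s))) (ℤP.*-zeroʳ (- pow a m)) ⟩
    ([X-1]^ m) (suc s) + + 0                            ≡⟨ ℤP.+-identityʳ _ ⟩
    ([X-1]^ m) (suc s)                                  ≡⟨ [X-1]^-coefficient m (suc s) ⟩
    + (m C suc s) * (- + 1 * (- + 1) ^ (2 ℕ.* n ℕ.+ suc s))
      ≡⟨ P.cong (λ x → + (m C suc s) * (- + 1 * x)) (-1^[2n+k]≡-1^k n (suc s)) ⟩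
    + (m C suc s) * (- + 1) ^ suc (suc s)               ∎
    where
    m : ℕ
    m = odd n

module IntegerImage {c ℓ} (R : CommutativeRing c ℓ) (a : ℤ) where
  open CommutativeRing R hiding (zero)
  open Poly R
  open IntegerCast R
  open Polynomials R
  open Recurrence R (ι a)
  open SetoidReasoning setoid
  private
    module ℤX = Polynomials ℤP.+-*-commutativeRing
    module ℤB = IntegerCoefficients a

  ι-· : ∀ r p k → ι ((ℤX.X- r · p) k) ≈ (X- ι r · (λ i → ι (p i))) k
  ι-· r p zero = trans (ι-homo-* (ℤ.- r) (p 0)) (*-congʳ (ι-homo-neg r))
  ι-· r p (suc k) =
    trans (ι-homo-+ (p k) (ℤ.- (r ℤ.* p (suc k))))
      (+-congˡ (trans (ι-homo-neg (r ℤ.* p (suc k))) (-‿cong (ι-homo-* r (p (suc k))))))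

  ι-X- : ∀ r k → ι (Poly.X-_ ℤP.+-*-commutativeRing r k) ≈ (X- ι r) k
  ι-X- r zero = ι-homo-neg r
  ι-X- r (suc zero) = ι-homo-1
  ι-X- r (suc (suc k)) = refl

  ι[1-a]≈1-ι[a] : ι (+ 1 ℤ.- a) ≈ 1# - ι a
  ι[1-a]≈1-ι[a] = trans (ι-homo-+ (+ 1) (ℤ.- a)) (+-cong ι-homo-1 (ι-homo-neg a))

  ι[a^k]≈ι[a]^k : ∀ k → ι (Poly.pow ℤP.+-*-commutativeRing a k) ≈ pow (ι a) k
  ι[a^k]≈ι[a]^k k = trans (reflexive (P.cong ι (ℤB.pow≡ℤ^ a k))) (ι-homo-^ a k)

  ι-B : ∀ n k → ι (ℤB.B n k) ≈ B n k
  ι-B zero zero = ι-homo-1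
  ι-B zero (suc k) = refl
  ι-B (suc n) k = begin
    ι (M k ℤ.+ αᵐ ℤ.* L k)                ≈⟨ trans (ι-homo-+ (M k) _) (+-congˡ (ι-homo-* αᵐ (L k))) ⟩
    ι (M k) + ι αᵐ * ι (L k)
      ≈⟨ +-cong (trans (ι-· (+ 1) _ k) (·-cong ι-homo-1 (λ i → trans (ι-· (+ 1) (ℤB.B n) i) (·-cong ι-homo-1 (ι-B n) i)) k))
                (*-cong (ι[a^k]≈ι[a]^k (odd n)) (trans (ι-X- (+ 1 ℤ.- a) k) (X-‿cong ι[1-a]≈1-ι[a] k))) ⟩
    B (suc n) k                           ∎
    where
    M L : ℕ → ℤ
    M = ℤX.X- + 1 · ℤX.X- + 1 · ℤB.B n
    L = Poly.X-_ ℤP.+-*-commutativeRing (+ 1 ℤ.- a)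
    αᵐ : ℤ
    αᵐ = Poly.pow ℤP.+-*-commutativeRing a (odd n)

module Factorisation {c ℓ} (R : CommutativeRing c ℓ) (domain : Poly.IsDomain R) (a : ℤ) (n : ℕ)
                     (z : CommutativeRing.Carrier R) (z-prim : Poly.IsPrimitiveRoot R (odd n) z) where
  open CommutativeRing R hiding (zero)
  open Poly R
  open IntegerCast R
  open Powers R
  open Polynomials R
  open Recurrence R (ι a)
  open PrimitiveRoots R domain
  open AbelianGroupProperties +-abelianGroup using (x∙y⁻¹≈ε⇒x≈y)
  open SetoidReasoning setoid

  α : Carrier
  α = ι a

  m : ℕ
  m = odd n

  u v : ℕ → Carrier
  u l = 1# + α * pow z l
  v l = 1# + α * pow z (m ∸ l)

  open QuadraticFactors u v

  G-monic : Monic (2 ℕ.* n) (G a z n)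
  G-monic = prod1-monic n

  H T D : Polynomial
  H = X- u 0 · G a z n
  T = difference-of-powers m
  D = H -ₚ T

  G-roots : ∀ i → 1 ℕ.≤ i → i ℕ.< m → eval m (G a z n) (u i) ≈ 0#
  G-roots i 1≤i i<m with i ℕ.≤? n
  ... | yes i≤n = prod1-root n i (u i) 1≤i i≤n (inj₁ refl)
  ... | no i≰n = prod1-root n (m ∸ i) (u i) (ℕP.m<n⇒0<n∸m i<m) (odd∸>≤ n i (ℕP.≰⇒> i≰n)) (inj₂ u≈v)
    where
    u≈v : u i ≈ v (m ∸ i)
    u≈v = reflexive (P.cong (λ e → 1# + α * pow z e) (P.sym (ℕP.m∸[m∸n]≡n (ℕP.<⇒≤ i<m))))

  H-roots : ∀ i → i ℕ.< m → eval (suc m) H (u i) ≈ 0#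
  H-roots i i<m = trans (eval-· m (u 0) (G a z n) (u i) (proj₂ G-monic m ℕP.≤-refl)) (vanish i i<m)
    where
    vanish : ∀ i → i ℕ.< m → (u i - u 0) * eval m (G a z n) (u i) ≈ 0#
    vanish zero _ = trans (*-congʳ (-‿inverseʳ (u 0))) (zeroˡ _)
    vanish (suc i) 1+i<m = trans (*-congˡ (G-roots (suc i) (s≤s z≤n) 1+i<m)) (zeroʳ _)

  T-roots : ∀ i → eval (suc m) T (u i) ≈ 0#
  T-roots i = begin
    eval (suc m) T (u i)                                     ≈⟨ eval-+ₚ (suc m) ([X-1]^ m) _ (u i) ⟩
    eval (suc m) ([X-1]^ m) (u i) + eval (suc m) (scale (- αᵐ) oneₚ) (u i)
      ≈⟨ +-cong (eval-[X-1]^ m (u i)) (trans (eval-scale (suc m) (- αᵐ) oneₚ (u i)) (*-congˡ (eval-constₚ m 1# (u i)))) ⟩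
    pow (u i - 1#) m + - αᵐ * 1#
      ≈⟨ +-cong (pow-congˡ m (solve 2 (λ a w → (:1 :+ a :* w) :- :1 := a :* w) refl α w)) (*-identityʳ _) ⟩
    pow (α * w) m - αᵐ     ≈⟨ +-congʳ (pow-distrib-* α w m) ⟩
    αᵐ * pow w m - αᵐ      ≈⟨ +-congʳ (trans (*-congˡ (pow-root-of-unity {z} {m} (proj₁ z-prim) i)) (*-identityʳ αᵐ)) ⟩
    αᵐ - αᵐ                ≈⟨ -‿inverseʳ αᵐ ⟩
    0#                     ∎
    where
    αᵐ w : Carrier
    αᵐ = pow α m
    w = pow z i

  T-monic : Monic m T
  T-monic = monic-+ ([X-1]^-monic m) λ { (suc k) _ → zeroʳ _ }

  D-degree : Degree< m D
  D-degree = monic-difference (·-monic (u 0) G-monic) T-monic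

  D-roots : ∀ i → i ℕ.< m → eval m D (u i) ≈ 0#
  D-roots i i<m = begin
    eval m D (u i)                                  ≈⟨ eval-suc m D (u i) (D-degree m ℕP.≤-refl) ⟨
    eval (suc m) D (u i)                            ≈⟨ eval-difference (suc m) H T (u i) ⟩
    eval (suc m) H (u i) - eval (suc m) T (u i)     ≈⟨ +-cong (H-roots i i<m) (-‿cong (T-roots i)) ⟩
    0# - 0#                                         ≈⟨ -‿inverseʳ 0# ⟩
    0#                                              ∎

  roots-distinct : ∀ i j → i ℕ.< j → j ℕ.< m → u j - u i ≈ 0# → α ≈ 0#
  roots-distinct i j i<j j<m uⱼ-uᵢ≈0 with proj₂ domain α (pow z j - pow z i) (trans factorised uⱼ-uᵢ≈0)
    where
    factorised : α * (pow z j - pow z i) ≈ u j - u i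
    factorised =
      solve 3 (λ a x y → a :* (y :- x) := (:1 :+ a :* y) :- (:1 :+ a :* x)) refl α (pow z i) (pow z j)
  ... | inj₁ α≈0 = α≈0
  ... | inj₂ zʲ-zⁱ≈0 = ⊥-elim (primitive-pow-injective z-prim i<j j<m (x∙y⁻¹≈ε⇒x≈y _ _ zʲ-zⁱ≈0))

  -- When α = 0 the points u i coincide, and both sides degenerate to (X - 1)^m.
  H≈T-degenerate : α ≈ 0# → H ≈ₚ T
  H≈T-degenerate α≈0 k = begin
    H k                                    ≈⟨ ·-cong (u≈1 0) (prod1-unit-roots u≈1 v≈1 n) k ⟩
    ([X-1]^ m) k
      ≈⟨ solve 3 (λ w x o → w := w :+ :- (:0 :* x) :* o) refl (([X-1]^ m) k) αⁿⁿ (oneₚ k) ⟩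
    ([X-1]^ m) k + - (0# * αⁿⁿ) * oneₚ k   ≈⟨ +-congˡ (*-congʳ (-‿cong (*-congʳ α≈0))) ⟨
    T k                                    ∎
    where
    αⁿⁿ : Carrier
    αⁿⁿ = pow α (2 ℕ.* n)
    near-1 : ∀ x → 1# + α * x ≈ 1#
    near-1 x = trans (+-congˡ (trans (*-congʳ α≈0) (zeroˡ x))) (+-identityʳ 1#)
    u≈1 : ∀ l → u l ≈ 1#
    u≈1 l = near-1 _
    v≈1 : ∀ l → v l ≈ 1#
    v≈1 l = near-1 _

  open RootCounting (proj₂ domain) (α ≈ 0#)

  H≈T : H ≈ₚ T
  H≈T = [ H≈T-degenerate , (λ D<m≈0 k → x∙y⁻¹≈ε⇒x≈y (H k) (T k) (D≈0 D<m≈0 k)) ]′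
          (roots⇒zero m u D roots-distinct (λ i i<m → inj₂ (D-roots i i<m)))
    where
    D≈0 : (∀ k → k ℕ.< m → D k ≈ 0#) → ∀ k → D k ≈ 0#
    D≈0 D<m≈0 k with k ℕ.<? m
    ... | yes k<m = D<m≈0 k k<m
    ... | no k≮m = D-degree k (ℕP.≮⇒≥ k≮m)

  G≈B : G a z n ≈ₚ B n
  G≈B = ·-cancel (u 0) {m} {G a z n} {B n} (proj₂ G-monic) (proj₂ (B-monic n)) λ k → begin
    H k                        ≈⟨ H≈T k ⟩
    T k                        ≈⟨ X-[1+α]·B≈difference-of-powers n k ⟨
    (X- (1# + α) · B n) k      ≈⟨ ·-cong (+-congˡ (sym (*-identityʳ α))) (λ _ → refl) k ⟩
    (X- u 0 · B n) k           ∎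

open import Data.Integer using (_+_; _-_; _*_; _^_; -_)

proposition3p2 : ∀ {c ℓ} (R : CommutativeRing c ℓ) → Poly.IsDomain R →
    (a : ℤ) → a ≢ + 0 → a ≢ + 1 → a ≢ - (+ 1) →
    (ζ : ℕ → CommutativeRing.Carrier R) → (∀ n → Poly.IsPrimitiveRoot R (odd n) (ζ n)) →
    (∀ n → Σ (ℕ → ℤ) λ b →
        (∀ k → k ℕ.≤ 2 ℕ.* n → CommutativeRing._≈_ R (Poly.G R a (ζ n) n k) (Poly.ι R (b k)))
      × (∀ k → 2 ℕ.* n ℕ.< k → CommutativeRing._≈_ R (Poly.G R a (ζ n) n k) (CommutativeRing.0# R))
      × (b 0 * (a + + 1) ≡ a ^ odd n + + 1)
      × (b (2 ℕ.* n) ≡ + 1)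
      × (∀ s → 1 ℕ.≤ s → s ℕ.< 2 ℕ.* n →
           b (s ∸ 1) - (a + + 1) * b s ≡ + (odd n C s) * (- (+ 1)) ^ suc s))
    × Poly._≈ₚ_ R (Poly.G R a (ζ 0) 0) (Poly.oneₚ R)
    × (∀ n → Poly._≈ₚ_ R (Poly.G R a (ζ (suc n)) (suc n))
         (Poly._+ₚ_ R (Poly._*ₚ_ R (Poly._*ₚ_ R (Poly.X-_ R (CommutativeRing.1# R)) (Poly.X-_ R (CommutativeRing.1# R))) (Poly.G R a (ζ n) n))
                      (Poly._*ₚ_ R (Poly.constₚ R (Poly.ι R (a ^ odd n))) (Poly.X-_ R (Poly.ι R (+ 1 - a))))))
proposition3p2 R domain a _ _ _ ζ ζ-prim =
    (λ n → B n , (λ k _ → G≈ιB n k) , proj₂ (Fₙ.G-monic n) , B-constant-term n , proj₁ (B-monic n) ,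
           λ { zero () _ ; (suc s) _ _ → B-consecutive n s })
  , (λ k → refl)
  , recurrence
  where
  open CommutativeRing R using (_≈_; 1#; refl; sym; trans; +-cong; *-cong)
  open Poly R using (G; ι; X-_; constₚ; _*ₚ_; _+ₚ_)
  open IntegerCast R using (ι-homo-^)
  open Polynomials R using (quadratic-*ₚ; constₚ-*ₚ; ·-cong; X-‿cong)
  open IntegerCoefficients a using (B; B-monic; B-constant-term; B-consecutive)
  open IntegerImage R a using (ι-B; ι[1-a]≈1-ι[a])
  module Fₙ (n : ℕ) = Factorisation R domain a n (ζ n) (ζ-prim n)

  G≈ιB : ∀ n k → G a (ζ n) n k ≈ ι (B n k)
  G≈ιB n k = trans (Fₙ.G≈B n k) (sym (ι-B n k))

  recurrence : ∀ n k → G a (ζ (suc n)) (suc n) k ≈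
               ((((X- 1#) *ₚ (X- 1#)) *ₚ G a (ζ n) n) +ₚ (constₚ (ι (a ^ odd n)) *ₚ (X- (ι (+ 1 - a))))) k
  recurrence n k = trans (Fₙ.G≈B (suc n) k) (sym (+-cong
    (trans (quadratic-*ₚ 1# 1# (G a (ζ n) n) k) (·-cong refl (·-cong refl (Fₙ.G≈B n)) k))
    (trans (constₚ-*ₚ (ι (a ^ odd n)) (X- (ι (+ 1 - a))) k)
           (*-cong (ι-homo-^ a (odd n)) (X-‿cong ι[1-a]≈1-ι[a] k)))))
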